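{- Let $\mathbf{F}_q$ be a finite field of characteristic $p$ and let $D=\mathbf{F}_q$. If $p$ is odd, then for a positive integer $k$, the statement "for every $b\in\mathbf{F}_q$ there exist pairwise distinct $x_1,\dots,x_k\in\mathbf{F}_q$ with $x_1+\cdots+x_k=b$" holds if and only if $0<k<q$. If $p=2$, then for every integer $k$ with $2<k<q-2$ and every $b\in\mathbf{F}_q$ there exist pairwise distinct $x_1,\dots,x_k\in\mathbf{F}_q$ with $x_1+\cdots+x_k=b$. -}

module Defs where

open import Level using (Level; _⊔_)
open import Algebra.Bundles using (CommutativeRing)
open import Data.Nat as ℕ using (ℕ; zero; suc; _<_)
open import Data.Fin using (Fin)
import Data.Fin as Fin
open import Data.Product using (Σ; ∃; _×_)
open import Relation.Nullary using (¬_)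
open import Relation.Binary.PropositionalEquality using (_≡_; _≢_)

record Field (c ℓ : Level) : Set (Level.suc (c ⊔ ℓ)) where
  field
    commutativeRing : CommutativeRing c ℓ
  open CommutativeRing commutativeRing public
  field
    1≉0     : ¬ (1# ≈ 0#)
    inverse : ∀ x → ¬ (x ≈ 0#) → ∃ λ y → (x * y) ≈ 1#

module _ {c ℓ : Level} (F : Field c ℓ) where
  open Field F using (Carrier; _≈_; _+_; 0#; 1#)

  natCast : ℕ → Carrier
  natCast zero    = 0#
  natCast (suc n) = 1# + natCast n

  HasCharacteristic : ℕ → Set ℓ
  HasCharacteristic n =
    (0 < n) × (natCast n ≈ 0#) × (∀ m → 0 < m → m < n → ¬ (natCast m ≈ 0#))

  HasCardinality : ℕ → Set (c ⊔ ℓ)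
  HasCardinality q =
    Σ (Fin q → Carrier) λ e →
      (∀ i j → e i ≈ e j → i ≡ j) × (∀ x → ∃ λ i → e i ≈ x)

  sumFin : (k : ℕ) → (Fin k → Carrier) → Carrier
  sumFin zero    xs = 0#
  sumFin (suc k) xs = xs Fin.zero + sumFin k (λ i → xs (Fin.suc i))

  PairwiseDistinct : {k : ℕ} → (Fin k → Carrier) → Set ℓ
  PairwiseDistinct {k} xs = ∀ (i j : Fin k) → i ≢ j → ¬ (xs i ≈ xs j)

  AllSumsOfDistinct : ℕ → Set (c ⊔ ℓ)
  AllSumsOfDistinct k =
    ∀ (b : Carrier) → ∃ λ (xs : Fin k → Carrier) →
      PairwiseDistinct xs × (sumFin k xs ≈ b)

-- Fix k distinct elements with sum s. If k ≠ 0 in F, translating them by t adds k·t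
-- to the sum, so every b is reached. If k = 0 in F, translation does not change the
-- sum, but scaling a k-set with nonzero sum reaches every b ≠ 0, so it remains to
-- find a k-set with sum 0.
-- In odd characteristic, take a k-set with sum s ≠ 0 and replace some x by x − s.
-- This fails only if the set is invariant under translation by −s, and then
-- comparing sums of squares gives 2s² = 0. For k = q the sum is the sum of all of F,
-- which is 0 because doubling permutes F; so b = 1 is missed.
-- In characteristic 2, k = 0 in F means k is even. Each pair {x, x + 1} sums to 1,
-- so 2m pairs give a zero-sum set of size 4m, and for size 4m + 2 the quadruple
-- {0, c, y, y + c + 1}, whose sum is 1, is added to 2m − 1 pairs.
{-# OPTIONS --safe #-}
module Submission where

open import Defs
open import Data.Nat using (ℕ; _<_; _∸_; _%_)
open import Data.Product using (_×_; ∃; ∃₂; _,_; proj₁; proj₂)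
open import Function.Bundles using (_⇔_; mk⇔)
open import Relation.Binary.PropositionalEquality using (_≡_)

open import Level using (_⊔_)
import Data.Nat as ℕ
import Data.Nat.Properties as ℕ
import Data.Nat.Tactic.RingSolver as NS
open import Data.Fin using (Fin)
import Data.Fin as Fin
open import Data.List using (List; []; _∷_; _++_; length; map; foldr; take; tabulate; lookup)
import Data.List.Properties as List
open import Data.List.Relation.Unary.All as All using ([]; _∷_)
import Data.List.Relation.Unary.All.Properties as Allₚ
open import Data.List.Relation.Unary.Any using (here; there)
import Data.List.Relation.Unary.Any as Any
open import Data.Sum using (_⊎_; inj₁; inj₂)
open import Function using (_∘_; case_of_)
open import Relation.Nullary using (Dec; yes; no)
open import Relation.Nullary.Negation using (contradiction)
open import Relation.Binary.Bundles using (Setoid; DecSetoid)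
import Relation.Binary.PropositionalEquality as ≡
import Data.List.Membership.Setoid as Membership
import Data.List.Membership.Setoid.Properties as Membershipₚ
import Data.List.Relation.Unary.Unique.Setoid as UniqueSetoid
import Data.List.Relation.Unary.Unique.Setoid.Properties as UniqueProperties
import Data.List.Relation.Binary.Subset.Setoid as Subset
import Data.List.Relation.Binary.Permutation.Setoid as Permutation
import Data.List.Relation.Binary.Permutation.Setoid.Properties as Permutationₚ

even⊎odd : ∀ n → ∃ λ m → n ≡ 2 ℕ.* m ⊎ n ≡ 1 ℕ.+ 2 ℕ.* m
even⊎odd ℕ.zero    = 0 , inj₁ ≡.refl
even⊎odd (ℕ.suc n) with even⊎odd n
... | m , inj₁ ≡.refl = m , inj₂ ≡.refl
... | m , inj₂ ≡.refl = ℕ.suc m , inj₁ (≡.sym (ℕ.*-suc 2 m))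

<∸⇒+< : ∀ {k q} n → k < q ∸ n → k ℕ.+ n < q
<∸⇒+< {k} {q}       ℕ.zero    k<q   = ≡.subst (_< q) (≡.sym (ℕ.+-identityʳ k)) k<q
<∸⇒+< {k} {ℕ.suc q} (ℕ.suc n) k<q∸n = ≡.subst (_< ℕ.suc q) (≡.sym (ℕ.+-suc k n)) (ℕ.s≤s (<∸⇒+< n k<q∸n))

room-for-pair : ∀ u n r → u ℕ.+ 2 ℕ.* ℕ.suc n ℕ.≤ ℕ.suc r → u < r × 2 ℕ.+ u ℕ.+ 2 ℕ.* n ℕ.≤ ℕ.suc r
room-for-pair u n r room = ℕ.s≤s⁻¹ (ℕ.≤-trans (ℕ.m≤m+n (2 ℕ.+ u) (2 ℕ.* n)) room′) , room′
  where
  +-2*-suc : ∀ u n → u ℕ.+ 2 ℕ.* ℕ.suc n ≡ 2 ℕ.+ u ℕ.+ 2 ℕ.* n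
  +-2*-suc = NS.solve-∀
  room′ : 2 ℕ.+ u ℕ.+ 2 ℕ.* n ℕ.≤ ℕ.suc r
  room′ = ≡.subst (ℕ._≤ ℕ.suc r) (+-2*-suc u n) room

module _ {a ℓ} (S : Setoid a ℓ) where
  open Setoid S
  open Membership S
  open UniqueSetoid S
  open Subset S
  open Permutation S using (_↭_; ↭-refl; ↭-trans; ↭-prep; ↭-sym; ↭-transˡ-≋)
  open Permutationₚ S
  open Membershipₚ

  ∈⇒↭∷ : ∀ {x ys} → x ∈ ys → ∃ λ zs → ys ↭ x ∷ zs
  ∈⇒↭∷ x∈ys with as , bs , w , x≈w , ys≋ ← ∈-∃++ S x∈ys =
    as ++ bs , ↭-transˡ-≋ ys≋ (shift (sym x≈w) as bs)

  Unique-⊆⇒↭++ : ∀ {xs ys} → Unique xs → xs ⊆ ys → ∃ λ zs → ys ↭ xs ++ zs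
  Unique-⊆⇒↭++ {[]}     {ys} _          _       = ys , ↭-refl
  Unique-⊆⇒↭++ {x ∷ xs}      (x≉xs ∷ u) x∷xs⊆ys
    with ws , ys↭x∷ws ← ∈⇒↭∷ (x∷xs⊆ys (here refl))
    with zs , ws↭xs++zs ← Unique-⊆⇒↭++ u (λ z∈xs →
           Any.tail (λ z≈x → All[≉]⇒∉ S x≉xs (∈-resp-≈ S z≈x z∈xs))
                    (∈-resp-↭ ys↭x∷ws (x∷xs⊆ys (there z∈xs))))
    = zs , ↭-trans ys↭x∷ws (↭-prep x ws↭xs++zs)

  Unique-⊆⇒length≤ : ∀ {xs ys} → Unique xs → xs ⊆ ys → length xs ℕ.≤ length ys
  Unique-⊆⇒length≤ {xs} u xs⊆ys with zs , ys↭xs++zs ← Unique-⊆⇒↭++ u xs⊆ys =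
    ≡.subst (length xs ℕ.≤_)
      (≡.sym (≡.trans (xs↭ys⇒|xs|≡|ys| ys↭xs++zs) (List.length-++ xs)))
      (ℕ.m≤m+n _ _)

  Unique-⊆-length≡⇒↭ : ∀ {xs ys} → Unique xs → xs ⊆ ys → length xs ≡ length ys → xs ↭ ys
  Unique-⊆-length≡⇒↭ {xs} {ys} u xs⊆ys |xs|≡|ys| with Unique-⊆⇒↭++ u xs⊆ys
  ... | [] , ys↭xs++[] = ↭-sym (≡.subst (ys ↭_) (List.++-identityʳ xs) ys↭xs++[])
  ... | _ ∷ _ , ys↭xs++zs = contradiction
    (≡.sym (≡.trans |xs|≡|ys| (≡.trans (xs↭ys⇒|xs|≡|ys| ys↭xs++zs) (List.length-++ xs))))
    (ℕ.m+1+n≢m (length xs))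

  Unique⇒lookup-injective : ∀ {xs} → Unique xs → ∀ i j → lookup xs i ≈ lookup xs j → i ≡ j
  Unique⇒lookup-injective {_ ∷ xs} _          Fin.zero    Fin.zero    _ = ≡.refl
  Unique⇒lookup-injective {_ ∷ xs} (x≉xs ∷ _) Fin.zero    (Fin.suc j) x≈ =
    contradiction (∈-resp-≈ S (sym x≈) (∈-lookup S xs j)) (All[≉]⇒∉ S x≉xs)
  Unique⇒lookup-injective {_ ∷ xs} (x≉xs ∷ _) (Fin.suc i) Fin.zero    ≈x =
    contradiction (∈-resp-≈ S ≈x (∈-lookup S xs i)) (All[≉]⇒∉ S x≉xs)
  Unique⇒lookup-injective {_ ∷ xs} (_ ∷ u)    (Fin.suc i) (Fin.suc j) eq =
    ≡.cong Fin.suc (Unique⇒lookup-injective u i j eq)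

module _ {a ℓ} (D : DecSetoid a ℓ) where
  open DecSetoid D
  open import Data.List.Membership.DecSetoid D
  open UniqueSetoid setoid

  Unique-length<⇒∃∉ : ∀ {xs ys} → Unique xs → length ys < length xs → ∃ λ x → x ∉ ys
  Unique-length<⇒∃∉ {xs} {ys} u |ys|<|xs| with All.all? (_∈? ys) xs
  ... | yes xs⊆ys = contradiction
    (Unique-⊆⇒length≤ setoid u (All.lookupₛ setoid (Membershipₚ.∈-resp-≈ setoid) xs⊆ys))
    (ℕ.<⇒≱ |ys|<|xs|)
  ... | no ¬xs⊆ys = Any.satisfied (Allₚ.¬All⇒Any¬ (_∈? ys) xs ¬xs⊆ys)

module FieldSums {c ℓ} (F : Field c ℓ) where
  open Field F
  open import Algebra.Properties.Semiring.Mult semiring using (×1-homo-*) renaming (_×_ to _·_)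
  open import Algebra.Properties.Group +-group using (∙-cancelˡ; ∙-cancelʳ)
  open import Algebra.Properties.AbelianGroup +-abelianGroup using (xyx⁻¹≈y)
  open import Relation.Binary.Reasoning.Setoid setoid
  open import Algebra.Solver.Ring.NaturalCoefficients.Default commutativeSemiring
  open UniqueSetoid setoid
  open Subset setoid using (_⊆_)
  open Permutation setoid using (_↭_)

  natCast≡·1# : ∀ n → natCast F n ≡ n · 1#
  natCast≡·1# ℕ.zero    = ≡.refl
  natCast≡·1# (ℕ.suc n) = ≡.cong (1# +_) (natCast≡·1# n)

  natCast-* : ∀ m n → natCast F (m ℕ.* n) ≈ natCast F m * natCast F n
  natCast-* m n rewrite natCast≡·1# (m ℕ.* n) | natCast≡·1# m | natCast≡·1# n = ×1-homo-* m n

  natCast-2 : natCast F 2 ≈ 1# + 1#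
  natCast-2 = +-cong refl (+-identityʳ 1#)

  odd-characteristic⇒1+1≉0 : ∀ {p} → HasCharacteristic F p → p % 2 ≡ 1 → 1# + 1# ≉ 0#
  odd-characteristic⇒1+1≉0 {1}                           (_ , 1≈0 , _)     _ _      =
    1≉0 (trans (sym (+-identityʳ 1#)) 1≈0)
  odd-characteristic⇒1+1≉0 {ℕ.suc (ℕ.suc (ℕ.suc _))} (_ , _ , minimal) _ 1+1≈0 =
    minimal 2 (ℕ.s≤s ℕ.z≤n) (ℕ.s≤s (ℕ.s≤s (ℕ.s≤s ℕ.z≤n))) (trans natCast-2 1+1≈0)

  *-cancelˡ-≉0 : ∀ {x y z} → x ≉ 0# → x * y ≈ x * z → y ≈ z
  *-cancelˡ-≉0 {x} {y} {z} x≉0 xy≈xz with x⁻¹ , xx⁻¹≈1 ← inverse x x≉0 = begin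
    y               ≈⟨ solve 1 (λ y → y := con 1 :* y) refl y ⟩
    1# * y          ≈⟨ *-cong (sym xx⁻¹≈1) refl ⟩
    x * x⁻¹ * y     ≈⟨ solve 3 (λ x x⁻¹ y → x :* x⁻¹ :* y := x⁻¹ :* (x :* y)) refl x x⁻¹ y ⟩
    x⁻¹ * (x * y)   ≈⟨ *-cong refl xy≈xz ⟩
    x⁻¹ * (x * z)   ≈⟨ solve 3 (λ x x⁻¹ z → x⁻¹ :* (x :* z) := x :* x⁻¹ :* z) refl x x⁻¹ z ⟩
    x * x⁻¹ * z     ≈⟨ *-cong xx⁻¹≈1 refl ⟩
    1# * z          ≈⟨ solve 1 (λ z → con 1 :* z := z) refl z ⟩
    z               ∎

  *-≈0⇒≈0 : ∀ {x y} → x ≉ 0# → x * y ≈ 0# → y ≈ 0#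
  *-≈0⇒≈0 {x} x≉0 xy≈0 = *-cancelˡ-≉0 x≉0 (trans xy≈0 (sym (zeroʳ x)))

  *-solvable : ∀ {a} → a ≉ 0# → ∀ b → ∃ λ t → a * t ≈ b
  *-solvable {a} a≉0 b with a⁻¹ , aa⁻¹≈1 ← inverse a a≉0 = b * a⁻¹ , (begin
    a * (b * a⁻¹)   ≈⟨ solve 3 (λ a b a⁻¹ → a :* (b :* a⁻¹) := b :* (a :* a⁻¹)) refl a b a⁻¹ ⟩
    b * (a * a⁻¹)   ≈⟨ *-cong refl aa⁻¹≈1 ⟩
    b * 1#          ≈⟨ *-identityʳ b ⟩
    b               ∎)

  x≈x+y⇒y≈0 : ∀ {x y} → x ≈ x + y → y ≈ 0#
  x≈x+y⇒y≈0 {x} {y} x≈x+y = ∙-cancelˡ x y 0# (trans (sym x≈x+y) (sym (+-identityʳ x)))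

  x≉x+1 : ∀ x → x ≉ x + 1#
  x≉x+1 x = 1≉0 ∘ x≈x+y⇒y≈0

  ∑ : List Carrier → Carrier
  ∑ = foldr _+_ 0#

  _² : Carrier → Carrier
  x ² = x * x

  ∑-↭ : ∀ {xs ys} → xs ↭ ys → ∑ xs ≈ ∑ ys
  ∑-↭ = Permutationₚ.foldr-commMonoid setoid +-isCommutativeMonoid

  ∑-++ : ∀ xs ys → ∑ (xs ++ ys) ≈ ∑ xs + ∑ ys
  ∑-++ []       ys = sym (+-identityˡ (∑ ys))
  ∑-++ (x ∷ xs) ys = trans (+-cong refl (∑-++ xs ys)) (sym (+-assoc x (∑ xs) (∑ ys)))

  ∑-map-+ : ∀ t xs → ∑ (map (_+ t) xs) ≈ ∑ xs + natCast F (length xs) * t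
  ∑-map-+ t []       = solve 1 (λ t → con 0 := con 0 :+ con 0 :* t) refl t
  ∑-map-+ t (x ∷ xs) = begin
    x + t + ∑ (map (_+ t) xs)                       ≈⟨ +-cong refl (∑-map-+ t xs) ⟩
    x + t + (∑ xs + natCast F (length xs) * t)      ≈⟨ solve 4 (λ x t s n → x :+ t :+ (s :+ n :* t) := x :+ s :+ (con 1 :+ n) :* t)
                                                          refl x t (∑ xs) (natCast F (length xs)) ⟩
    x + ∑ xs + (1# + natCast F (length xs)) * t     ∎

  ∑-map-* : ∀ a xs → ∑ (map (a *_) xs) ≈ a * ∑ xs
  ∑-map-* a []       = sym (zeroʳ a)
  ∑-map-* a (x ∷ xs) = trans (+-cong refl (∑-map-* a xs)) (sym (distribˡ a x (∑ xs)))

  ∑-map-²-+ : ∀ a xs → ∑ (map _² (map (_+ a) xs)) ≈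
              ∑ (map _² xs) + (1# + 1#) * a * ∑ xs + natCast F (length xs) * a ²
  ∑-map-²-+ a []       = solve 1 (λ a → con 0 := con 0 :+ con 2 :* a :* con 0 :+ con 0 :* (a :* a)) refl a
  ∑-map-²-+ a (x ∷ xs) = begin
    (x + a) ² + ∑ (map _² (map (_+ a) xs))
      ≈⟨ +-cong refl (∑-map-²-+ a xs) ⟩
    (x + a) ² + (Q + (1# + 1#) * a * S + n * a ²)
      ≈⟨ solve 5 (λ x a Q S n → (x :+ a) :* (x :+ a) :+ (Q :+ con 2 :* a :* S :+ n :* (a :* a))
                              := x :* x :+ Q :+ con 2 :* a :* (x :+ S) :+ (con 1 :+ n) :* (a :* a))
                refl x a Q S n ⟩
    x ² + Q + (1# + 1#) * a * (x + S) + (1# + n) * a ²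
      ∎
    where
    Q = ∑ (map _² xs)
    S = ∑ xs
    n = natCast F (length xs)

  -- The translate is a permutation of xs, so its sum of squares is that of xs, while
  -- expanding (x + a)² with |xs| = 0 in F adds exactly 2a · ∑ xs.
  map-+-⊆⇒*∑≈0 : ∀ {a xs} → 1# + 1# ≉ 0# → natCast F (length xs) ≈ 0# → Unique xs →
                 map (_+ a) xs ⊆ xs → a * ∑ xs ≈ 0#
  map-+-⊆⇒*∑≈0 {a} {xs} 2≉0 n≈0 u shifted⊆xs = *-≈0⇒≈0 2≉0 (∙-cancelˡ Q _ _ (begin
    Q + (1# + 1#) * (a * S)                              ≈⟨ solve 3 (λ Q a S → Q :+ con 2 :* (a :* S) := Q :+ con 2 :* a :* S :+ con 0 :* (a :* a)) refl Q a S ⟩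
    Q + (1# + 1#) * a * S + 0# * a ²                     ≈⟨ +-cong refl (*-cong (sym n≈0) refl) ⟩
    Q + (1# + 1#) * a * S + natCast F (length xs) * a ²  ≈⟨ ∑-map-²-+ a xs ⟨
    ∑ (map _² (map (_+ a) xs))                           ≈⟨ ∑-↭ (Permutationₚ.map⁺ setoid setoid (λ x≈y → *-cong x≈y x≈y) shifted↭xs) ⟩
    Q                                                    ≈⟨ +-identityʳ Q ⟨
    Q + 0#                                               ∎))
    where
    Q = ∑ (map _² xs)
    S = ∑ xs
    shifted↭xs : map (_+ a) xs ↭ xs
    shifted↭xs = Unique-⊆-length≡⇒↭ setoid
      (UniqueProperties.map⁺ setoid setoid (∙-cancelʳ a _ _) u) shifted⊆xs (List.length-map _ xs)

  DistinctSum : ℕ → Carrier → List Carrier → Set (c ⊔ ℓ)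
  DistinctSum k b xs = Unique xs × length xs ≡ k × ∑ xs ≈ b

  translate-DistinctSum : ∀ {k s xs} → natCast F k ≉ 0# → DistinctSum k s xs →
                          ∀ b → ∃ (DistinctSum k b)
  translate-DistinctSum {k} {s} {xs} k≉0 (u , |xs|≡k , ∑xs≈s) b
    with t , kt≈b-s ← *-solvable k≉0 (b - s) =
    map (_+ t) xs ,
    UniqueProperties.map⁺ setoid setoid (∙-cancelʳ t _ _) u ,
    ≡.trans (List.length-map _ xs) |xs|≡k ,
    (begin
      ∑ (map (_+ t) xs)                  ≈⟨ ∑-map-+ t xs ⟩
      ∑ xs + natCast F (length xs) * t   ≈⟨ +-cong ∑xs≈s (*-cong (reflexive (≡.cong (natCast F) |xs|≡k)) refl) ⟩
      s + natCast F k * t                ≈⟨ +-cong refl kt≈b-s ⟩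
      s + (b - s)                        ≈⟨ +-assoc s b (- s) ⟨
      s + b - s                          ≈⟨ xyx⁻¹≈y s b ⟩
      b                                  ∎)

  scale-DistinctSum : ∀ {k s xs} → s ≉ 0# → DistinctSum k s xs →
                      ∀ {b} → b ≉ 0# → ∃ (DistinctSum k b)
  scale-DistinctSum {k} {s} {xs} s≉0 (u , |xs|≡k , ∑xs≈s) {b} b≉0
    with a , sa≈b ← *-solvable s≉0 b =
    map (a *_) xs ,
    UniqueProperties.map⁺ setoid setoid (*-cancelˡ-≉0 a≉0) u ,
    ≡.trans (List.length-map _ xs) |xs|≡k ,
    (begin
      ∑ (map (a *_) xs)   ≈⟨ ∑-map-* a xs ⟩
      a * ∑ xs            ≈⟨ *-cong refl ∑xs≈s ⟩
      a * s               ≈⟨ *-comm a s ⟩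
      s * a               ≈⟨ sa≈b ⟩
      b                   ∎)
    where
    a≉0 : a ≉ 0#
    a≉0 a≈0 = b≉0 (trans (sym sa≈b) (trans (*-cong refl a≈0) (zeroʳ s)))

  sumFin≈∑tabulate : ∀ k (f : Fin k → Carrier) → sumFin F k f ≈ ∑ (tabulate f)
  sumFin≈∑tabulate ℕ.zero    f = refl
  sumFin≈∑tabulate (ℕ.suc k) f = +-cong refl (sumFin≈∑tabulate k (f ∘ Fin.suc))

  DistinctSum⇒family : ∀ {k b} → ∃ (DistinctSum k b) →
                       ∃ λ (f : Fin k → Carrier) → PairwiseDistinct F f × sumFin F k f ≈ b
  DistinctSum⇒family (xs , u , ≡.refl , ∑xs≈b) =
    lookup xs ,
    (λ i j i≢j → i≢j ∘ Unique⇒lookup-injective setoid u i j) ,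
    trans (sumFin≈∑tabulate _ (lookup xs)) (trans (reflexive (≡.cong ∑ (List.tabulate-lookup xs))) ∑xs≈b)

  family⇒DistinctSum : ∀ {k b} (f : Fin k → Carrier) → PairwiseDistinct F f → sumFin F k f ≈ b →
                       DistinctSum k b (tabulate f)
  family⇒DistinctSum {k} f distinct sum≈b =
    UniqueProperties.tabulate⁺ setoid injective ,
    List.length-tabulate f ,
    trans (sym (sumFin≈∑tabulate k f)) sum≈b
    where
    injective : ∀ {i j} → f i ≈ f j → i ≡ j
    injective {i} {j} fi≈fj with i Fin.≟ j
    ... | yes i≡j = i≡j
    ... | no  i≢j = contradiction fi≈fj (distinct i j i≢j)

module FiniteField {c ℓ} (F : Field c ℓ) (q : ℕ) (card : HasCardinality F q) where
  open Field F
  open FieldSums F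
  open Membership setoid
  open UniqueSetoid setoid
  open Subset setoid using (_⊆_)
  open Permutation setoid using (_↭_)
  open import Algebra.Properties.Group +-group using (∙-cancelʳ; ⁻¹-injective; ε⁻¹≈ε)
  open import Relation.Binary.Reasoning.Setoid setoid
  open import Algebra.Solver.Ring.NaturalCoefficients.Default commutativeSemiring

  private
    e : Fin q → Carrier
    e = proj₁ card

    e-injective : ∀ i j → e i ≈ e j → i ≡ j
    e-injective = proj₁ (proj₂ card)

    e-surjective : ∀ x → ∃ λ i → e i ≈ x
    e-surjective = proj₂ (proj₂ card)

  _≟_ : ∀ x y → Dec (x ≈ y)
  x ≟ y with i , ei≈x ← e-surjective x | j , ej≈y ← e-surjective y with i Fin.≟ j
  ... | yes i≡j = yes (trans (sym ei≈x) (trans (reflexive (≡.cong e i≡j)) ej≈y))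
  ... | no  i≢j = no (λ x≈y → i≢j (e-injective i j (trans ei≈x (trans x≈y (sym ej≈y)))))

  decSetoid : DecSetoid c ℓ
  decSetoid = record { isDecEquivalence = record { isEquivalence = isEquivalence ; _≟_ = _≟_ } }

  open import Data.List.Membership.DecSetoid decSetoid using (_∈?_)

  elements : List Carrier
  elements = tabulate e

  Unique-elements : Unique elements
  Unique-elements = UniqueProperties.tabulate⁺ setoid (e-injective _ _)

  ∈-elements : ∀ x → x ∈ elements
  ∈-elements x with i , ei≈x ← e-surjective x =
    Membershipₚ.∈-resp-≈ setoid ei≈x (Membershipₚ.∈-tabulate⁺ setoid i)

  length-elements : length elements ≡ q
  length-elements = List.length-tabulate e

  Unique⇒length≤q : ∀ {xs} → Unique xs → length xs ℕ.≤ q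
  Unique⇒length≤q u = ≡.subst (_ ℕ.≤_) length-elements
    (Unique-⊆⇒length≤ setoid u (λ {x} _ → ∈-elements x))

  Unique-length≡q⇒↭elements : ∀ {xs} → Unique xs → length xs ≡ q → xs ↭ elements
  Unique-length≡q⇒↭elements u |xs|≡q = Unique-⊆-length≡⇒↭ setoid u
    (λ {x} _ → ∈-elements x) (≡.trans |xs|≡q (≡.sym length-elements))

  ∃∉ : ∀ {ys} → length ys < q → ∃ λ x → x ∉ ys
  ∃∉ |ys|<q = Unique-length<⇒∃∉ decSetoid Unique-elements
    (≡.subst (_ <_) (≡.sym length-elements) |ys|<q)

  ∃-Unique-of-length : ∀ {k} → k ℕ.≤ q → ∃ λ xs → Unique xs × length xs ≡ k
  ∃-Unique-of-length {k} k≤q =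
    take k elements ,
    UniqueProperties.take⁺ setoid k Unique-elements ,
    ≡.trans (List.length-take k elements)
            (ℕ.m≤n⇒m⊓n≡m (≡.subst (k ℕ.≤_) (≡.sym length-elements) k≤q))

  ∃-nonzero-DistinctSum : ∀ {k} → 0 < k → k < q → ∃₂ λ s xs → s ≉ 0# × DistinctSum k s xs
  ∃-nonzero-DistinctSum {k} 0<k k<q with ∃-Unique-of-length (ℕ.<⇒≤ k<q)
  ... | [] , _ , ≡.refl = contradiction 0<k λ ()
  ... | x ∷ xs , u@(_ ∷ u′) , |x∷xs|≡k with ∑ (x ∷ xs) ≟ 0#
  ...   | no ∑≉0 = _ , x ∷ xs , ∑≉0 , u , |x∷xs|≡k , refl
  ...   | yes ∑≈0 with y , y∉x∷xs ← ∃∉ (≡.subst (_< q) (≡.sym |x∷xs|≡k) k<q) =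
    y + ∑ xs , y ∷ xs , y+∑≉0 ,
    Membershipₚ.∉⇒All[≉] setoid (y∉x∷xs ∘ there) ∷ u′ , |x∷xs|≡k , refl
    where
    y+∑≉0 : y + ∑ xs ≉ 0#
    y+∑≉0 y+∑≈0 = y∉x∷xs (here (∙-cancelʳ (∑ xs) y x (trans y+∑≈0 (sym ∑≈0))))

  ∃-DistinctSum : ∀ {k} → 0 < k → k < q → (natCast F k ≈ 0# → ∃ (DistinctSum k 0#)) →
            ∀ b → ∃ (DistinctSum k b)
  ∃-DistinctSum {k} 0<k k<q zeroSum b
    with s , xs , s≉0 , s-sum ← ∃-nonzero-DistinctSum 0<k k<q
    with natCast F k ≟ 0# | b ≟ 0#
  ... | no k≉0 | _       = translate-DistinctSum k≉0 s-sum b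
  ... | yes _  | no b≉0  = scale-DistinctSum s≉0 s-sum b≉0
  ... | yes k≈0 | yes b≈0 with zs , u , |zs|≡k , ∑zs≈0 ← zeroSum k≈0 =
    zs , u , |zs|≡k , trans ∑zs≈0 (sym b≈0)

  -- Replace some x by x − s; if no x allows this, xs is closed under translation by −s.
  ∃-zero-DistinctSum-odd : 1# + 1# ≉ 0# → ∀ {k s xs} → natCast F k ≈ 0# → s ≉ 0# →
                         DistinctSum k s xs → ∃ (DistinctSum k 0#)
  ∃-zero-DistinctSum-odd 2≉0 {k} {s} {xs} k≈0 s≉0 (u , |xs|≡k , ∑xs≈s)
    with All.all? (λ x → x - s ∈? xs) xs
  ... | yes closed = contradiction s≈0 s≉0
    where
    shifted⊆xs : map (_- s) xs ⊆ xs
    shifted⊆xs y∈shifted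
      with x , x∈xs , y≈x-s ← Membershipₚ.∈-map⁻ setoid setoid y∈shifted =
      Membershipₚ.∈-resp-≈ setoid (sym y≈x-s)
        (All.lookupₛ setoid (λ x≈y → Membershipₚ.∈-resp-≈ setoid (+-cong x≈y refl)) closed x∈xs)
    -s≈0 : - s ≈ 0#
    -s≈0 = *-≈0⇒≈0 s≉0 (trans (*-comm s (- s)) (trans (*-cong refl (sym ∑xs≈s))
             (map-+-⊆⇒*∑≈0 2≉0 (trans (reflexive (≡.cong (natCast F) |xs|≡k)) k≈0) u shifted⊆xs)))
    s≈0 : s ≈ 0#
    s≈0 = ⁻¹-injective (trans -s≈0 (sym ε⁻¹≈ε))
  ... | no ¬closed
    with x , x∈xs , x-s∉xs ← find (Allₚ.¬All⇒Any¬ (λ x → x - s ∈? xs) xs ¬closed)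
    with ws , xs↭x∷ws ← ∈⇒↭∷ setoid x∈xs =
    x - s ∷ ws ,
    Membershipₚ.∉⇒All[≉] setoid (x-s∉xs ∘ ws⊆xs) ∷ ws-unique ,
    ≡.trans (≡.sym (Permutationₚ.xs↭ys⇒|xs|≡|ys| setoid xs↭x∷ws)) |xs|≡k ,
    (begin
      x - s + ∑ ws   ≈⟨ solve 3 (λ x m w → x :+ m :+ w := x :+ w :+ m) refl x (- s) (∑ ws) ⟩
      x + ∑ ws - s   ≈⟨ +-cong (trans (sym (∑-↭ xs↭x∷ws)) ∑xs≈s) refl ⟩
      s - s          ≈⟨ -‿inverseʳ s ⟩
      0#             ∎)
    where
    ws⊆xs : ws ⊆ xs
    ws⊆xs z∈ws = Permutationₚ.∈-resp-↭ setoid (Permutation.↭-sym setoid xs↭x∷ws) (there z∈ws)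
    ws-unique : Unique ws
    ws-unique with _ ∷ ws-unique ← Permutationₚ.Unique-resp-↭ setoid xs↭x∷ws u = ws-unique

  ∑elements≈0 : 1# + 1# ≉ 0# → ∑ elements ≈ 0#
  ∑elements≈0 2≉0 = ∙-cancelʳ S S 0# (begin
    S + S                              ≈⟨ solve 1 (λ S → S :+ S := con 2 :* S) refl S ⟩
    (1# + 1#) * S                      ≈⟨ ∑-map-* (1# + 1#) elements ⟨
    ∑ (map ((1# + 1#) *_) elements)    ≈⟨ ∑-↭ doubled↭elements ⟩
    S                                  ≈⟨ +-identityˡ S ⟨
    0# + S                             ∎)
    where
    S = ∑ elements
    doubled↭elements : map ((1# + 1#) *_) elements ↭ elements
    doubled↭elements = Unique-length≡q⇒↭elements
      (UniqueProperties.map⁺ setoid setoid (*-cancelˡ-≉0 2≉0) Unique-elements)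
      (≡.trans (List.length-map _ elements) length-elements)

  AllSumsOfDistinct⇒<q : 1# + 1# ≉ 0# → ∀ {k} → AllSumsOfDistinct F k → k < q
  AllSumsOfDistinct⇒<q 2≉0 {k} sums
    with f , distinct , sum≈1 ← sums 1#
    with u , |f|≡k , ∑f≈1 ← family⇒DistinctSum f distinct sum≈1 =
    ℕ.≤∧≢⇒< (≡.subst (ℕ._≤ q) |f|≡k (Unique⇒length≤q u)) λ k≡q → 1≉0 (begin
      1#                 ≈⟨ ∑f≈1 ⟨
      ∑ (tabulate f)     ≈⟨ ∑-↭ (Unique-length≡q⇒↭elements u (≡.trans |f|≡k k≡q)) ⟩
      ∑ elements         ≈⟨ ∑elements≈0 2≉0 ⟩
      0#                 ∎)

  AllSumsOfDistinct-odd : 1# + 1# ≉ 0# → ∀ {k} → 0 < k → k < q → AllSumsOfDistinct F k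
  AllSumsOfDistinct-odd 2≉0 {k} 0<k k<q b = DistinctSum⇒family (∃-DistinctSum 0<k k<q zeroSum b)
    where
    zeroSum : natCast F k ≈ 0# → ∃ (DistinctSum k 0#)
    zeroSum k≈0 with s , xs , s≉0 , s-sum ← ∃-nonzero-DistinctSum 0<k k<q =
      ∃-zero-DistinctSum-odd 2≉0 k≈0 s≉0 s-sum

  module Characteristic2 (1+1≈0 : 1# + 1# ≈ 0#) where
    open import Data.List.Relation.Binary.Disjoint.Setoid setoid using (Disjoint)

    x+x≈0 : ∀ x → x + x ≈ 0#
    x+x≈0 x = begin
      x + x          ≈⟨ solve 1 (λ x → x :+ x := con 2 :* x) refl x ⟩
      (1# + 1#) * x  ≈⟨ *-cong 1+1≈0 refl ⟩
      0# * x         ≈⟨ zeroˡ x ⟩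
      0#             ∎

    +≈0⇒≈ : ∀ {x y} → x + y ≈ 0# → x ≈ y
    +≈0⇒≈ {x} {y} x+y≈0 = ∙-cancelʳ y x y (trans x+y≈0 (sym (x+x≈0 y)))

    x+1+1≈x : ∀ x → x + 1# + 1# ≈ x
    x+1+1≈x x = trans (+-assoc x 1# 1#) (trans (+-cong refl 1+1≈0) (+-identityʳ x))

    natCast-2* : ∀ m → natCast F (2 ℕ.* m) ≈ 0#
    natCast-2* m = begin
      natCast F (2 ℕ.* m)         ≈⟨ natCast-* 2 m ⟩
      natCast F 2 * natCast F m   ≈⟨ *-cong (trans natCast-2 1+1≈0) refl ⟩
      0# * natCast F m            ≈⟨ zeroˡ _ ⟩
      0#                          ∎

    natCast-1+2* : ∀ m → natCast F (1 ℕ.+ 2 ℕ.* m) ≈ 1#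
    natCast-1+2* m = trans (+-cong refl (natCast-2* m)) (+-identityʳ 1#)

    pairUp : List Carrier → List Carrier
    pairUp []       = []
    pairUp (x ∷ xs) = x ∷ x + 1# ∷ pairUp xs

    length-pairUp : ∀ xs → length (pairUp xs) ≡ 2 ℕ.* length xs
    length-pairUp []       = ≡.refl
    length-pairUp (x ∷ xs) = ≡.trans (≡.cong (2 ℕ.+_) (length-pairUp xs)) (≡.sym (ℕ.*-suc 2 (length xs)))

    PairClosed : List Carrier → Set (c ⊔ ℓ)
    PairClosed U = ∀ {x} → x ∈ U → x + 1# ∈ U

    ∑-pairUp : ∀ xs → ∑ (pairUp xs) ≈ natCast F (length xs)
    ∑-pairUp []       = refl
    ∑-pairUp (x ∷ xs) = begin
      x + (x + 1# + ∑ (pairUp xs))   ≈⟨ solve 2 (λ x w → x :+ (x :+ con 1 :+ w) := x :+ x :+ (con 1 :+ w)) refl x (∑ (pairUp xs)) ⟩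
      x + x + (1# + ∑ (pairUp xs))   ≈⟨ +-cong (x+x≈0 x) (+-cong refl (∑-pairUp xs)) ⟩
      0# + (1# + natCast F (length xs)) ≈⟨ +-identityˡ _ ⟩
      1# + natCast F (length xs)     ∎

    pairUp-++-closed : ∀ {U} → PairClosed U → ∀ xs → PairClosed (pairUp xs ++ U)
    pairUp-++-closed U-closed []       z∈U                  = U-closed z∈U
    pairUp-++-closed U-closed (x ∷ xs) (here z≈x)           = there (here (+-cong z≈x refl))
    pairUp-++-closed U-closed (x ∷ xs) (there (here z≈x+1)) = here (trans (+-cong z≈x+1 refl) (x+1+1≈x x))
    pairUp-++-closed U-closed (x ∷ xs) (there (there z∈))   =
      there (there (pairUp-++-closed U-closed xs z∈))

    -- Each pair needs only one fresh element x, its partner x + 1 is fresh because U is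
    -- pair-closed; hence the bound q + 1 rather than q.
    ∃-pairs : ∀ n {U} → PairClosed U → length U ℕ.+ 2 ℕ.* n ℕ.≤ ℕ.suc q →
              ∃ λ xs → length xs ≡ n × Unique (pairUp xs) × Disjoint (pairUp xs) U
    ∃-pairs ℕ.zero    _        _    = [] , ≡.refl , [] , λ ()
    ∃-pairs (ℕ.suc n) {U} U-closed room
      with |U|<q , room′ ← room-for-pair (length U) n q room
      with x , x∉U ← ∃∉ |U|<q
      with xs , |xs|≡n , unique , disjoint ← ∃-pairs n (pairUp-++-closed U-closed (x ∷ [])) room′ =
      x ∷ xs , ≡.cong ℕ.suc |xs|≡n ,
      (x≉x+1 x ∷ Membershipₚ.∉⇒All[≉] setoid (λ x∈ → disjoint (x∈ , here refl)))
        ∷ Membershipₚ.∉⇒All[≉] setoid (λ x+1∈ → disjoint (x+1∈ , there (here refl))) ∷ unique ,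
      λ { (here z≈x , z∈U)           → x∉U (Membershipₚ.∈-resp-≈ setoid z≈x z∈U)
        ; (there (here z≈x+1) , z∈U) → x∉U (Membershipₚ.∈-resp-≈ setoid (trans (+-cong z≈x+1 refl) (x+1+1≈x x)) (U-closed z∈U))
        ; (there (there z∈) , z∈U)   → disjoint (z∈ , there (there z∈U)) }

    -- The quadruple lies in pairUp (0# ∷ c ∷ y ∷ y + c ∷ []), so pairs chosen outside that
    -- pair-closed set are disjoint from it.
    quadruple : Carrier → Carrier → List Carrier
    quadruple c y = 0# ∷ c ∷ y ∷ y + c + 1# ∷ []

    quadruple-unique : ∀ {c y} → c ∉ pairUp (0# ∷ []) → y ∉ pairUp (0# ∷ c ∷ []) → Unique (quadruple c y)
    quadruple-unique {c} {y} c∉ y∉ =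
      (c≉0 ∘ sym ∷ y≉0 ∘ sym ∷ (λ 0≈y+c+1 → y≉c+1 (+≈0⇒≈ (trans (sym (+-assoc y c 1#)) (sym 0≈y+c+1)))) ∷ [])
      ∷ (y≉c ∘ sym ∷ (λ c≈y+c+1 → y≉1 (+≈0⇒≈ (x≈x+y⇒y≈0 (trans c≈y+c+1
            (solve 3 (λ y c o → y :+ c :+ o := c :+ (y :+ o)) refl y c 1#))))) ∷ [])
      ∷ ((λ y≈y+c+1 → c≉1 (+≈0⇒≈ (x≈x+y⇒y≈0 (trans y≈y+c+1 (+-assoc y c 1#))))) ∷ [])
      ∷ [] ∷ []
      where
      c≉0 : c ≉ 0#
      c≉0 c≈0 = c∉ (here c≈0)
      c≉1 : c ≉ 1#
      c≉1 c≈1 = c∉ (there (here (trans c≈1 (sym (+-identityˡ 1#)))))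
      y≉0 : y ≉ 0#
      y≉0 y≈0 = y∉ (here y≈0)
      y≉1 : y ≉ 1#
      y≉1 y≈1 = y∉ (there (here (trans y≈1 (sym (+-identityˡ 1#)))))
      y≉c : y ≉ c
      y≉c y≈c = y∉ (there (there (here y≈c)))
      y≉c+1 : y ≉ c + 1#
      y≉c+1 y≈c+1 = y∉ (there (there (there (here y≈c+1))))

    quadruple⊆pairUp : ∀ c y → quadruple c y ⊆ pairUp (0# ∷ c ∷ y ∷ y + c ∷ [])
    quadruple⊆pairUp c y (here z≈0)                             = here z≈0
    quadruple⊆pairUp c y (there (here z≈c))                     = there (there (here z≈c))
    quadruple⊆pairUp c y (there (there (here z≈y)))             = there (there (there (there (here z≈y))))
    quadruple⊆pairUp c y (there (there (there (here z≈y+c+1)))) =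
      there (there (there (there (there (there (there (here z≈y+c+1)))))))

    ∑-quadruple : ∀ c y → ∑ (quadruple c y) ≈ 1#
    ∑-quadruple c y = begin
      0# + (c + (y + (y + c + 1# + 0#)))  ≈⟨ solve 2 (λ c y → con 0 :+ (c :+ (y :+ (y :+ c :+ con 1 :+ con 0)))
                                                          := c :+ y :+ (c :+ y) :+ con 1) refl c y ⟩
      c + y + (c + y) + 1#                ≈⟨ +-cong (x+x≈0 (c + y)) refl ⟩
      0# + 1#                             ≈⟨ +-identityˡ 1# ⟩
      1#                                  ∎

    quadruple++pairUp : ∀ {m c y xs} → c ∉ pairUp (0# ∷ []) → y ∉ pairUp (0# ∷ c ∷ []) →
                        length xs ≡ 1 ℕ.+ 2 ℕ.* m → Unique (pairUp xs) →
                        Disjoint (pairUp xs) (pairUp (0# ∷ c ∷ y ∷ y + c ∷ [])) →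
                        DistinctSum (4 ℕ.+ 2 ℕ.* (1 ℕ.+ 2 ℕ.* m)) 0# (quadruple c y ++ pairUp xs)
    quadruple++pairUp {m} {c} {y} {xs} c∉ y∉ |xs|≡1+2m pairs-unique disjoint =
      UniqueProperties.++⁺ setoid (quadruple-unique c∉ y∉) pairs-unique
        (λ (z∈quadruple , z∈pairs) → disjoint (z∈pairs , quadruple⊆pairUp c y z∈quadruple)) ,
      ≡.cong (4 ℕ.+_) (≡.trans (length-pairUp xs) (≡.cong (2 ℕ.*_) |xs|≡1+2m)) ,
      (begin
        ∑ (quadruple c y ++ pairUp xs)       ≈⟨ ∑-++ (quadruple c y) (pairUp xs) ⟩
        ∑ (quadruple c y) + ∑ (pairUp xs)    ≈⟨ +-cong (∑-quadruple c y) (∑-pairUp xs) ⟩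
        1# + natCast F (length xs)           ≈⟨ +-cong refl (reflexive (≡.cong (natCast F) |xs|≡1+2m)) ⟩
        1# + natCast F (1 ℕ.+ 2 ℕ.* m)       ≈⟨ +-cong refl (natCast-1+2* m) ⟩
        1# + 1#                              ≈⟨ 1+1≈0 ⟩
        0#                                   ∎)

    ∃-zero-DistinctSum-4+pairs : ∀ m → 8 ℕ.+ 2 ℕ.* (1 ℕ.+ 2 ℕ.* m) ℕ.≤ ℕ.suc q →
                                 ∃ (DistinctSum (4 ℕ.+ 2 ℕ.* (1 ℕ.+ 2 ℕ.* m)) 0#)
    ∃-zero-DistinctSum-4+pairs m room
      with c , c∉ ← ∃∉ {pairUp (0# ∷ [])} (ℕ.≤-trans (ℕ.m≤m+n 3 _) (ℕ.s≤s⁻¹ room))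
      with y , y∉ ← ∃∉ {pairUp (0# ∷ c ∷ [])} (ℕ.≤-trans (ℕ.m≤m+n 5 _) (ℕ.s≤s⁻¹ room)) =
      -- not a with: abstracting over ∃-pairs (1 + 2m) makes Agda unfold it and run out of memory
      case ∃-pairs (1 ℕ.+ 2 ℕ.* m) (pairUp-++-closed (λ ()) (0# ∷ c ∷ y ∷ y + c ∷ [])) room of λ where
        (xs , |xs|≡1+2m , pairs-unique , disjoint) →
          quadruple c y ++ pairUp xs , quadruple++pairUp {m} c∉ y∉ |xs|≡1+2m pairs-unique disjoint

    ∃-zero-DistinctSum-even : ∀ n → 1 < n → 2 ℕ.* n ℕ.+ 2 < q → ∃ (DistinctSum (2 ℕ.* n) 0#)
    ∃-zero-DistinctSum-even n 1<n room with even⊎odd n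
    ... | m , inj₁ ≡.refl
      with xs , |xs|≡2m , unique , _ ← ∃-pairs (2 ℕ.* m) {[]} (λ ())
                                         (ℕ.m≤n⇒m≤1+n (ℕ.≤-trans (ℕ.m≤m+n _ 2) (ℕ.<⇒≤ room))) =
      pairUp xs , unique ,
      ≡.trans (length-pairUp xs) (≡.cong (2 ℕ.*_) |xs|≡2m) ,
      trans (∑-pairUp xs) (trans (reflexive (≡.cong (natCast F) |xs|≡2m)) (natCast-2* m))
    ... | ℕ.zero  , inj₂ ≡.refl = contradiction 1<n (ℕ.<-irrefl ≡.refl)
    ... | ℕ.suc m , inj₂ ≡.refl =
      ≡.subst (λ k → ∃ (DistinctSum k 0#)) (length≡ m)
        (∃-zero-DistinctSum-4+pairs m (≡.subst (ℕ._≤ ℕ.suc q) (room≡ m) (ℕ.s≤s room)))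
      where
      length≡ : ∀ m → 4 ℕ.+ 2 ℕ.* (1 ℕ.+ 2 ℕ.* m) ≡ 2 ℕ.* (1 ℕ.+ 2 ℕ.* ℕ.suc m)
      length≡ = NS.solve-∀
      room≡ : ∀ m → ℕ.suc (ℕ.suc (2 ℕ.* (1 ℕ.+ 2 ℕ.* ℕ.suc m) ℕ.+ 2)) ≡ 8 ℕ.+ 2 ℕ.* (1 ℕ.+ 2 ℕ.* m)
      room≡ = NS.solve-∀

    AllSumsOfDistinct-char2 : ∀ {k} → 2 < k → k ℕ.+ 2 < q → AllSumsOfDistinct F k
    AllSumsOfDistinct-char2 {k} 2<k k+2<q b =
      DistinctSum⇒family (∃-DistinctSum (ℕ.≤-trans (ℕ.s≤s ℕ.z≤n) 2<k) (ℕ.≤-trans (ℕ.m≤m+n (ℕ.suc k) 2) k+2<q) zeroSum b)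
      where
      zeroSum : natCast F k ≈ 0# → ∃ (DistinctSum k 0#)
      zeroSum k≈0 with even⊎odd k
      ... | n , inj₁ ≡.refl = ∃-zero-DistinctSum-even n (ℕ.*-cancelˡ-< 2 1 n 2<k) k+2<q
      ... | n , inj₂ ≡.refl = contradiction (trans (sym (natCast-1+2* n)) k≈0) 1≉0

corollary2p8 : ∀ {c ℓ} (F : Field c ℓ) (q p : ℕ) →
    HasCardinality F q → HasCharacteristic F p →
    ((p % 2 ≡ 1) → ∀ (k : ℕ) → 0 < k → (AllSumsOfDistinct F k ⇔ (0 < k × k < q)))
    × ((p ≡ 2) → ∀ (k : ℕ) → 2 < k → k < q ∸ 2 → AllSumsOfDistinct F k)
corollary2p8 F q p card char = odd-case , even-case
  where
  open Field F
  open FieldSums F using (natCast-2; odd-characteristic⇒1+1≉0)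
  open FiniteField F q card

  odd-case : p % 2 ≡ 1 → ∀ k → 0 < k → AllSumsOfDistinct F k ⇔ (0 < k × k < q)
  odd-case p-odd k 0<k = mk⇔
    (λ sums → 0<k , AllSumsOfDistinct⇒<q 1+1≉0 sums)
    (λ (_ , k<q) → AllSumsOfDistinct-odd 1+1≉0 0<k k<q)
    where
    1+1≉0 : 1# + 1# ≉ 0#
    1+1≉0 = odd-characteristic⇒1+1≉0 char p-odd

  even-case : p ≡ 2 → ∀ k → 2 < k → k < q ∸ 2 → AllSumsOfDistinct F k
  even-case ≡.refl k 2<k k<q∸2 =
    Characteristic2.AllSumsOfDistinct-char2 (trans (sym natCast-2) (proj₁ (proj₂ char))) 2<k (<∸⇒+< 2 k<q∸2)
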